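{- For all integers $m,n\ge 0$, $$E_{m,n}(x)=\sum_{\mu=0}^n\sum_{l=\mu}^n\left\{ {l \atop \mu} \right\}\binom{n}{l}E_{m,n-l}(-\mu)\,(x)^{(\mu)}.$$
   Context: For a non-negative integer $m$, the truncated Euler polynomials $E_{m,n}(x)$ are defined by the generating function $$\frac{\frac{2t^m}{m!}e^{xt}}{e^t+1-\sum_{j=0}^{m-1}\frac{t^j}{j!}}=\sum_{n=0}^\infty E_{m,n}(x)\frac{t^n}{n!}.$$ $\left\{ {n \atop k} \right\}$ denotes the Stirling numbers of the second kind, given by $\frac{(e^t-1)^k}{k!}=\sum_{n=0}^\infty \left\{ {n \atop k} \right\}\frac{t^n}{n!}$. The rising factorial is $(x)^{(n)}=x(x+1)\cdots(x+n-1)$ for $n\ge1$, $(x)^{(0)}=1$. -}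

module Defs where

open import Data.Nat as ℕ using (ℕ; zero; suc; _≤ᵇ_; _!)
open import Data.Nat.Properties using (_!≢0)
open import Data.Nat.Combinatorics using (_C_)
open import Data.Bool using (if_then_else_)
open import Data.Integer using (+_)
open import Data.Rational as ℚ using (ℚ; 0ℚ; 1ℚ; _+_; _*_; _-_; 1/_; -_)

⟦_⟧ : ℕ → ℚ
⟦ n ⟧ = (+ n) ℚ./ 1

infixr 8 _^_
_^_ : ℚ → ℕ → ℚ
x ^ zero = 1ℚ
x ^ suc n = x * (x ^ n)

sum0to : ℕ → (ℕ → ℚ) → ℚ
sum0to zero f = f 0
sum0to (suc n) f = sum0to n f + f (suc n)

sumFromTo : ℕ → ℕ → (ℕ → ℚ) → ℚ
sumFromTo a n f = sum0to n (λ i → if a ≤ᵇ i then f i else 0ℚ)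

-- Formal power series over ℚ, given by ordinary coefficients: f ↦ Σ f n tⁿ
Series : Set
Series = ℕ → ℚ

_⊛_ : Series → Series → Series
(f ⊛ g) n = sum0to n (λ k → f k * g (n ℕ.∸ k))

inv! : ℕ → ℚ
inv! n = ℚ._/_ (+ 1) (n !) {{n !≢0}}

expS : ℚ → Series
expS x n = (x ^ n) * inv! n

numer : ℕ → ℚ → Series
numer m x = (λ n → if n ℕ.≡ᵇ m then ⟦ 2 ⟧ * inv! m else 0ℚ) ⊛ expS x

denom : ℕ → Series
denom m n = (inv! n + (if n ℕ.≡ᵇ 0 then 1ℚ else 0ℚ))
            - (if suc n ≤ᵇ m then inv! n else 0ℚ)

-- inverse of the constant term of the denominator (it is 2 if m = 0, else 1)
denom₀⁻¹ : ℕ → ℚ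
denom₀⁻¹ zero = 1/ (denom zero 0)
denom₀⁻¹ (suc m) = 1/ (denom (suc m) 0)

-- quotient series q = N / D determined by q ⊛ D = N, computed by the
-- standard recursion; prefix n k gives q_k for k ≤ n.
private
  prefix : ℕ → Series → Series → ℚ → ℕ → ℚ
  prefix zero N D c k = N 0 * c
  prefix (suc n) N D c k =
    if k ≤ᵇ n then prefix n N D c k
    else (N (suc n) - sum0to n (λ j → prefix n N D c j * D (suc n ℕ.∸ j))) * c

divS : Series → Series → ℚ → Series
divS N D c n = prefix n N D c n

-- truncated Euler polynomial  E_{m,n}(x) = n! [tⁿ] (2tᵐ/m! e^{xt}) / (e^t + 1 - Σ_{j<m} tʲ/j!)
E : ℕ → ℕ → ℚ → ℚ
E m n x = ⟦ n ! ⟧ * divS (numer m x) (denom m) (denom₀⁻¹ m) n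

S₂ : ℕ → ℕ → ℕ
S₂ zero zero = 1
S₂ zero (suc k) = 0
S₂ (suc n) zero = 0
S₂ (suc n) (suc k) = suc k ℕ.* S₂ n (suc k) ℕ.+ S₂ n k

rising : ℚ → ℕ → ℚ
rising x zero = 1ℚ
rising x (suc n) = rising x n * (x + ⟦ n ⟧)

-- Let q_z(n) = E_{m,n}(z)/n!. Since the generating function is (2tᵐ/m!) e^{zt} divided by a series
-- independent of z, q_z = q_0 · e^{zt}. As Σ_l S(l,μ) tˡ/l! = (eᵗ - 1)^μ/μ!, the inner sum over l is
-- n! [tⁿ] (eᵗ - 1)^μ/μ! · q_0 · e^{-μt}, so it remains to see Σ_μ (x)^{(μ)} (eᵗ - 1)^μ/μ! · e^{-μt} = e^{xt},
-- the binomial series of (1 - (1 - e^{-t}))^{-x}. With an extra factor e^{yt} this is proved coefficientwise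
-- by induction on the degree: by (x)^{(μ+1)} = x (x+1)^{(μ)}, the derivative of the left side L(x, y) is
-- y L(x, y) + x L(x + 1, y - 1), matching the derivative (x + y) e^{(x+y)t} of the right side.
module Submission where

open import Defs
open import Data.Nat as ℕ using (ℕ; zero; suc; _∸_; _≤ᵇ_; _!; z≤n; s≤s)
import Data.Nat.Properties as ℕ
open import Data.Nat.Combinatorics using (_C_; nCk≡n!/k![n-k]!; k![n∸k]!∣n!)
open import Data.Nat.DivMod using (m/n*n≡m)
open import Data.Nat.Induction using (<-rec)
import Data.Integer as ℤ
import Data.Integer.Properties as ℤ
open import Data.Rational using (ℚ; _+_; _*_; _-_; -_; _/_; 0ℚ; 1ℚ; toℚᵘ)
import Data.Rational.Properties as ℚ
open import Data.Rational.Unnormalised as ℚᵘ using (mkℚᵘ; *≡*; _≃_)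
import Data.Rational.Unnormalised.Properties as ℚᵘ
open import Data.Bool using (true; false; if_then_else_; T)
open import Data.Bool.Properties using (T-≡)
open import Data.Product using (Σ; _,_; proj₁)
open import Function.Bundles using (Equivalence)
open import Relation.Nullary using (¬_; yes; no; contradiction)
open import Relation.Binary.PropositionalEquality
open import Data.Rational.Solver using (module +-*-Solver)
open +-*-Solver using (solve; _:+_; _:*_; _:-_; _:=_; con)

toℚᵘ-/ : ∀ i d → toℚᵘ (i / suc d) ≃ mkℚᵘ i d
toℚᵘ-/ i d = ℚ.toℚᵘ-fromℚᵘ (mkℚᵘ i d)

⟦⟧-homo-+ : ∀ a b → ⟦ a ℕ.+ b ⟧ ≡ ⟦ a ⟧ + ⟦ b ⟧
⟦⟧-homo-+ a b = ℚ.toℚᵘ-injective (begin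
  toℚᵘ ⟦ a ℕ.+ b ⟧                              ≈⟨ toℚᵘ-/ (ℤ.+ (a ℕ.+ b)) 0 ⟩
  mkℚᵘ (ℤ.+ (a ℕ.+ b)) 0                          ≈⟨ *≡* (cong (ℤ._* ℤ.+ 1) (trans (ℤ.pos-+ a b)
                                                      (sym (cong₂ ℤ._+_ (ℤ.*-identityʳ (ℤ.+ a)) (ℤ.*-identityʳ (ℤ.+ b)))))) ⟩
  mkℚᵘ (ℤ.+ a) 0 ℚᵘ.+ mkℚᵘ (ℤ.+ b) 0                ≈⟨ ℚᵘ.+-cong (toℚᵘ-/ (ℤ.+ a) 0) (toℚᵘ-/ (ℤ.+ b) 0) ⟨
  toℚᵘ ⟦ a ⟧ ℚᵘ.+ toℚᵘ ⟦ b ⟧                    ≈⟨ ℚ.toℚᵘ-homo-+ ⟦ a ⟧ ⟦ b ⟧ ⟨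
  toℚᵘ (⟦ a ⟧ + ⟦ b ⟧)                          ∎)
  where open ℚᵘ.≃-Reasoning

⟦⟧-homo-* : ∀ a b → ⟦ a ℕ.* b ⟧ ≡ ⟦ a ⟧ * ⟦ b ⟧
⟦⟧-homo-* a b = ℚ.toℚᵘ-injective (begin
  toℚᵘ ⟦ a ℕ.* b ⟧                              ≈⟨ toℚᵘ-/ (ℤ.+ (a ℕ.* b)) 0 ⟩
  mkℚᵘ (ℤ.+ (a ℕ.* b)) 0                          ≈⟨ *≡* (cong (ℤ._* ℤ.+ 1) (ℤ.pos-* a b)) ⟩
  mkℚᵘ (ℤ.+ a) 0 ℚᵘ.* mkℚᵘ (ℤ.+ b) 0                ≈⟨ ℚᵘ.*-cong (toℚᵘ-/ (ℤ.+ a) 0) (toℚᵘ-/ (ℤ.+ b) 0) ⟨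
  toℚᵘ ⟦ a ⟧ ℚᵘ.* toℚᵘ ⟦ b ⟧                    ≈⟨ ℚ.toℚᵘ-homo-* ⟦ a ⟧ ⟦ b ⟧ ⟨
  toℚᵘ (⟦ a ⟧ * ⟦ b ⟧)                          ∎)
  where open ℚᵘ.≃-Reasoning

⟦n⟧*1/n≡1 : ∀ n → .{{_ : ℕ.NonZero n}} → ⟦ n ⟧ * (ℤ.+ 1 / n) ≡ 1ℚ
⟦n⟧*1/n≡1 (suc d) = ℚ.toℚᵘ-injective (begin
  toℚᵘ (⟦ suc d ⟧ * (ℤ.+ 1 / suc d))        ≈⟨ ℚ.toℚᵘ-homo-* ⟦ suc d ⟧ _ ⟩
  toℚᵘ ⟦ suc d ⟧ ℚᵘ.* toℚᵘ (ℤ.+ 1 / suc d)  ≈⟨ ℚᵘ.*-cong (toℚᵘ-/ (ℤ.+ suc d) 0) (toℚᵘ-/ (ℤ.+ 1) d) ⟩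
  mkℚᵘ (ℤ.+ suc d) 0 ℚᵘ.* mkℚᵘ (ℤ.+ 1) d                    ≈⟨ *≡* (cong (λ k → ℤ.+ suc k) d*1*1≡d+0+0) ⟩
  ℚᵘ.1ℚᵘ                                                ∎)
  where
  open ℚᵘ.≃-Reasoning
  d*1*1≡d+0+0 : (d ℕ.* 1) ℕ.* 1 ≡ (d ℕ.+ 0) ℕ.+ 0
  d*1*1≡d+0+0 = trans (ℕ.*-identityʳ _) (trans (ℕ.*-identityʳ d) (sym (trans (ℕ.+-identityʳ _) (ℕ.+-identityʳ d))))

⟦n!⟧*inv!≡1 : ∀ n → ⟦ n ! ⟧ * inv! n ≡ 1ℚ
⟦n!⟧*inv!≡1 n = ⟦n⟧*1/n≡1 (n !) {{n ℕ.!≢0}}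

inv!-suc : ∀ n → inv! n ≡ ⟦ suc n ⟧ * inv! (suc n)
inv!-suc n = begin
  inv! n                                               ≡⟨ ℚ.*-identityʳ (inv! n) ⟨
  inv! n * 1ℚ                                          ≡⟨ cong (inv! n *_) (⟦n!⟧*inv!≡1 (suc n)) ⟨
  inv! n * (⟦ suc n ℕ.* n ! ⟧ * inv! (suc n))          ≡⟨ cong (λ t → inv! n * (t * inv! (suc n))) (⟦⟧-homo-* (suc n) (n !)) ⟩
  inv! n * (⟦ suc n ⟧ * ⟦ n ! ⟧ * inv! (suc n))        ≡⟨ solve 4 (λ i a b j → i :* (a :* b :* j) := (b :* i) :* (a :* j)) refl
                                                            (inv! n) ⟦ suc n ⟧ ⟦ n ! ⟧ (inv! (suc n)) ⟩
  (⟦ n ! ⟧ * inv! n) * (⟦ suc n ⟧ * inv! (suc n))      ≡⟨ cong (_* (⟦ suc n ⟧ * inv! (suc n))) (⟦n!⟧*inv!≡1 n) ⟩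
  1ℚ * (⟦ suc n ⟧ * inv! (suc n))                      ≡⟨ ℚ.*-identityˡ _ ⟩
  ⟦ suc n ⟧ * inv! (suc n)                             ∎
  where open ≡-Reasoning

sum-cong-≤ : ∀ n {f g : ℕ → ℚ} → (∀ i → i ℕ.≤ n → f i ≡ g i) → sum0to n f ≡ sum0to n g
sum-cong-≤ zero    f≡g = f≡g 0 z≤n
sum-cong-≤ (suc n) f≡g = cong₂ _+_ (sum-cong-≤ n (λ i i≤n → f≡g i (ℕ.m≤n⇒m≤1+n i≤n))) (f≡g (suc n) ℕ.≤-refl)

sum-cong : ∀ n {f g : ℕ → ℚ} → (∀ i → f i ≡ g i) → sum0to n f ≡ sum0to n g
sum-cong n f≡g = sum-cong-≤ n (λ i _ → f≡g i)

sum-+ : ∀ n (f g : ℕ → ℚ) → sum0to n (λ i → f i + g i) ≡ sum0to n f + sum0to n g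
sum-+ zero    f g = refl
sum-+ (suc n) f g = trans (cong (_+ (f (suc n) + g (suc n))) (sum-+ n f g))
  (solve 4 (λ a b c d → (a :+ b) :+ (c :+ d) := (a :+ c) :+ (b :+ d)) refl
    (sum0to n f) (sum0to n g) (f (suc n)) (g (suc n)))

*-distribˡ-sum : ∀ n c (f : ℕ → ℚ) → c * sum0to n f ≡ sum0to n (λ i → c * f i)
*-distribˡ-sum zero    c f = refl
*-distribˡ-sum (suc n) c f =
  trans (ℚ.*-distribˡ-+ c (sum0to n f) (f (suc n))) (cong (_+ c * f (suc n)) (*-distribˡ-sum n c f))

*-distribʳ-sum : ∀ n c (f : ℕ → ℚ) → sum0to n f * c ≡ sum0to n (λ i → f i * c)
*-distribʳ-sum n c f =
  trans (ℚ.*-comm (sum0to n f) c) (trans (*-distribˡ-sum n c f) (sum-cong n (λ i → ℚ.*-comm c (f i))))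

sum-uncons : ∀ n (f : ℕ → ℚ) → sum0to (suc n) f ≡ f 0 + sum0to n (λ i → f (suc i))
sum-uncons zero    f = refl
sum-uncons (suc n) f = trans (cong (_+ f (suc (suc n))) (sum-uncons n f)) (ℚ.+-assoc (f 0) _ _)

sum-head : ∀ n (f : ℕ → ℚ) → (∀ i → f (suc i) ≡ 0ℚ) → sum0to n f ≡ f 0
sum-head zero    f tail≡0 = refl
sum-head (suc n) f tail≡0 = trans (cong₂ _+_ (sum-head n f tail≡0) (tail≡0 n)) (ℚ.+-identityʳ (f 0))

sum-comm : ∀ n m (f : ℕ → ℕ → ℚ) →
           sum0to n (λ i → sum0to m (f i)) ≡ sum0to m (λ j → sum0to n (λ i → f i j))
sum-comm zero    m f = refl
sum-comm (suc n) m f = trans (cong (_+ sum0to m (f (suc n))) (sum-comm n m f))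
  (sym (sum-+ m (λ j → sum0to n (λ i → f i j)) (f (suc n))))

sum-reverse : ∀ n (f : ℕ → ℚ) → sum0to n f ≡ sum0to n (λ i → f (n ∸ i))
sum-reverse zero    f = refl
sum-reverse (suc n) f = trans (cong (_+ f (suc n)) (sum-reverse n f))
  (trans (ℚ.+-comm _ (f (suc n))) (sym (sum-uncons n (λ i → f (suc n ∸ i)))))

sum-triangle : ∀ n (F : ℕ → ℕ → ℚ) →
               sum0to n (λ i → sum0to i (F i)) ≡ sum0to n (λ j → sum0to (n ∸ j) (λ k → F (j ℕ.+ k) j))
sum-triangle zero    F = refl
sum-triangle (suc n) F = begin
  sum0to n (λ i → sum0to i (F i)) + sum0to (suc n) (F (suc n))            ≡⟨ cong (_+ sum0to (suc n) (F (suc n))) (sum-triangle n F) ⟩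
  sum0to n (column n) + (sum0to n (F (suc n)) + F (suc n) (suc n))         ≡⟨ ℚ.+-assoc (sum0to n (column n)) _ _ ⟨
  (sum0to n (column n) + sum0to n (F (suc n))) + F (suc n) (suc n)         ≡⟨ cong₂ _+_ (sym (sum-+ n _ _)) (sym last-column) ⟩
  sum0to n (λ j → column n j + F (suc n) j) + column (suc n) (suc n)       ≡⟨ cong (_+ column (suc n) (suc n)) (sum-cong-≤ n grow) ⟩
  sum0to (suc n) (column (suc n))                                          ∎
  where
  open ≡-Reasoning
  column : ℕ → ℕ → ℚ
  column n j = sum0to (n ∸ j) (λ k → F (j ℕ.+ k) j)
  grow : ∀ j → j ℕ.≤ n → column n j + F (suc n) j ≡ column (suc n) j
  grow j j≤n = sym (trans (cong (λ t → sum0to t (λ k → F (j ℕ.+ k) j)) (ℕ.+-∸-assoc 1 j≤n))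
    (cong (λ t → column n j + F t j) (trans (ℕ.+-suc j (n ∸ j)) (cong suc (ℕ.m+[n∸m]≡n j≤n)))))
  last-column : column (suc n) (suc n) ≡ F (suc n) (suc n)
  last-column = trans (cong (λ t → sum0to t (λ k → F (suc n ℕ.+ k) (suc n))) (ℕ.n∸n≡0 n))
    (cong (λ t → F t (suc n)) (ℕ.+-identityʳ (suc n)))

⊛-comm : ∀ (f g : Series) n → (f ⊛ g) n ≡ (g ⊛ f) n
⊛-comm f g n = trans (sum-reverse n (λ k → f k * g (n ∸ k)))
  (sum-cong-≤ n (λ i i≤n → trans (cong (λ t → f (n ∸ i) * g t) (ℕ.m∸[m∸n]≡n i≤n)) (ℚ.*-comm (f (n ∸ i)) (g i))))

⊛-congˡ : ∀ {f f′ : Series} (g : Series) → (∀ k → f k ≡ f′ k) → ∀ n → (f ⊛ g) n ≡ (f′ ⊛ g) n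
⊛-congˡ g f≡f′ n = sum-cong n (λ k → cong (_* g (n ∸ k)) (f≡f′ k))

⊛-congʳ : ∀ (f : Series) {g g′ : Series} → (∀ k → g k ≡ g′ k) → ∀ n → (f ⊛ g) n ≡ (f ⊛ g′) n
⊛-congʳ f g≡g′ n = sum-cong n (λ k → cong (f k *_) (g≡g′ (n ∸ k)))

⊛-assoc : ∀ (f g h : Series) n → ((f ⊛ g) ⊛ h) n ≡ (f ⊛ (g ⊛ h)) n
⊛-assoc f g h n = begin
  sum0to n (λ i → (f ⊛ g) i * h (n ∸ i))                               ≡⟨ sum-cong n (λ i → *-distribʳ-sum i (h (n ∸ i)) _) ⟩
  sum0to n (λ i → sum0to i (λ j → f j * g (i ∸ j) * h (n ∸ i)))        ≡⟨ sum-triangle n (λ i j → f j * g (i ∸ j) * h (n ∸ i)) ⟩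
  sum0to n (λ j → sum0to (n ∸ j) (λ k → f j * g (j ℕ.+ k ∸ j) * h (n ∸ (j ℕ.+ k))))
                                                                        ≡⟨ sum-cong n (λ j → sum-cong (n ∸ j) (reindex j)) ⟩
  sum0to n (λ j → sum0to (n ∸ j) (λ k → f j * (g k * h (n ∸ j ∸ k))))  ≡⟨ sum-cong n (λ j → *-distribˡ-sum (n ∸ j) (f j) _) ⟨
  (f ⊛ (g ⊛ h)) n                                                      ∎
  where
  open ≡-Reasoning
  reindex : ∀ j k → f j * g (j ℕ.+ k ∸ j) * h (n ∸ (j ℕ.+ k)) ≡ f j * (g k * h (n ∸ j ∸ k))
  reindex j k = trans (cong₂ (λ a b → f j * g a * h b) (ℕ.m+n∸m≡n j k) (sym (ℕ.∸-+-assoc n j k)))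
    (ℚ.*-assoc (f j) (g k) (h (n ∸ j ∸ k)))

⊛-expS0 : ∀ (f : Series) n → (f ⊛ expS 0ℚ) n ≡ f n
⊛-expS0 f n = begin
  (f ⊛ expS 0ℚ) n     ≡⟨ ⊛-comm f (expS 0ℚ) n ⟩
  (expS 0ℚ ⊛ f) n     ≡⟨ sum-head n (λ k → expS 0ℚ k * f (n ∸ k))
                           (λ i → trans (cong (_* f (n ∸ suc i)) (expS0-suc i)) (ℚ.*-zeroˡ (f (n ∸ suc i)))) ⟩
  1ℚ * f n            ≡⟨ ℚ.*-identityˡ (f n) ⟩
  f n                 ∎
  where
  open ≡-Reasoning
  expS0-suc : ∀ i → expS 0ℚ (suc i) ≡ 0ℚ
  expS0-suc i = trans (cong (_* inv! (suc i)) (ℚ.*-zeroˡ (0ℚ ^ i))) (ℚ.*-zeroˡ (inv! (suc i)))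

deriv : Series → Series
deriv f k = ⟦ suc k ⟧ * f (suc k)

deriv-⊛ : ∀ (f g : Series) k → deriv (f ⊛ g) k ≡ (deriv f ⊛ g) k + (f ⊛ deriv g) k
deriv-⊛ f g k = begin
  ⟦ suc k ⟧ * (f ⊛ g) (suc k)                                         ≡⟨ *-distribˡ-sum (suc k) ⟦ suc k ⟧ _ ⟩
  sum0to (suc k) (λ i → ⟦ suc k ⟧ * (f i * g (suc k ∸ i)))            ≡⟨ sum-cong-≤ (suc k) split ⟩
  sum0to (suc k) (λ i → ⟦ i ⟧ * (f i * g (suc k ∸ i)) + f i * (⟦ suc k ∸ i ⟧ * g (suc k ∸ i)))
                                                                       ≡⟨ sum-+ (suc k) _ _ ⟩
  sum0to (suc k) (λ i → ⟦ i ⟧ * (f i * g (suc k ∸ i)))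
    + sum0to (suc k) (λ i → f i * (⟦ suc k ∸ i ⟧ * g (suc k ∸ i)))     ≡⟨ cong₂ _+_ left right ⟩
  (deriv f ⊛ g) k + (f ⊛ deriv g) k                                   ∎
  where
  open ≡-Reasoning
  split : ∀ i → i ℕ.≤ suc k →
          ⟦ suc k ⟧ * (f i * g (suc k ∸ i)) ≡ ⟦ i ⟧ * (f i * g (suc k ∸ i)) + f i * (⟦ suc k ∸ i ⟧ * g (suc k ∸ i))
  split i i≤k = trans (cong (λ t → ⟦ t ⟧ * (f i * g (suc k ∸ i))) (sym (ℕ.m+[n∸m]≡n i≤k)))
    (trans (cong (_* (f i * g (suc k ∸ i))) (⟦⟧-homo-+ i (suc k ∸ i)))
      (solve 4 (λ a b u v → (a :+ b) :* (u :* v) := a :* (u :* v) :+ u :* (b :* v)) refl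
        ⟦ i ⟧ ⟦ suc k ∸ i ⟧ (f i) (g (suc k ∸ i))))
  left : sum0to (suc k) (λ i → ⟦ i ⟧ * (f i * g (suc k ∸ i))) ≡ (deriv f ⊛ g) k
  left = trans (sum-uncons k _)
    (trans (cong (_+ sum0to k (λ i → ⟦ suc i ⟧ * (f (suc i) * g (k ∸ i)))) (ℚ.*-zeroˡ (f 0 * g (suc k))))
    (trans (ℚ.+-identityˡ _) (sum-cong k (λ i → sym (ℚ.*-assoc ⟦ suc i ⟧ (f (suc i)) (g (k ∸ i)))))))
  right : sum0to (suc k) (λ i → f i * (⟦ suc k ∸ i ⟧ * g (suc k ∸ i))) ≡ (f ⊛ deriv g) k
  right = trans (cong₂ _+_ (sum-cong-≤ k (λ i i≤k → cong (λ t → f i * (⟦ t ⟧ * g t)) (ℕ.+-∸-assoc 1 i≤k)))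
                           (trans (cong (λ t → f (suc k) * (⟦ t ⟧ * g t)) (ℕ.n∸n≡0 k))
                                  (trans (cong (f (suc k) *_) (ℚ.*-zeroˡ (g 0))) (ℚ.*-zeroʳ (f (suc k))))))
    (ℚ.+-identityʳ _)

deriv-expS : ∀ z k → deriv (expS z) k ≡ z * expS z k
deriv-expS z k = begin
  ⟦ suc k ⟧ * (z * z ^ k * inv! (suc k))       ≡⟨ solve 4 (λ c z p j → c :* (z :* p :* j) := z :* (p :* (c :* j))) refl
                                                     ⟦ suc k ⟧ z (z ^ k) (inv! (suc k)) ⟩
  z * (z ^ k * (⟦ suc k ⟧ * inv! (suc k)))     ≡⟨ cong (λ t → z * (z ^ k * t)) (inv!-suc k) ⟨
  z * expS z k                                 ∎
  where open ≡-Reasoning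

*-inverse⇒solve : ∀ {a b c d} → d * c ≡ 1ℚ → a * d ≡ b → a ≡ b * c
*-inverse⇒solve {a} {b} {c} {d} d*c≡1 a*d≡b = begin
  a            ≡⟨ ℚ.*-identityʳ a ⟨
  a * 1ℚ       ≡⟨ cong (a *_) d*c≡1 ⟨
  a * (d * c)  ≡⟨ ℚ.*-assoc a d c ⟨
  a * d * c    ≡⟨ cong (_* c) a*d≡b ⟩
  b * c        ∎
  where open ≡-Reasoning

+-move-left : ∀ {x y z} → x + y ≡ z → y ≡ z - x
+-move-left {x} {y} {z} x+y≡z = trans (solve 2 (λ x y → y := (x :+ y) :- x) refl x y) (cong (_- x) x+y≡z)

if-≤ᵇ-yes : ∀ {k n} {x y : ℚ} → k ℕ.≤ n → (if k ≤ᵇ n then x else y) ≡ x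
if-≤ᵇ-yes k≤n rewrite Equivalence.to T-≡ (ℕ.≤⇒≤ᵇ k≤n) = refl

if-≤ᵇ-no : ∀ {k n} {x y : ℚ} → ¬ k ℕ.≤ n → (if k ≤ᵇ n then x else y) ≡ y
if-≤ᵇ-no {k} {n} k≰n with k ≤ᵇ n in k≤ᵇn
... | true  = contradiction (ℕ.≤ᵇ⇒≤ k n (subst T (sym k≤ᵇn) _)) k≰n
... | false = refl

module Division (N D : Series) (c : ℚ) where

  private
    step : (ℕ → ℚ) → ℕ → ℕ → ℚ
    step p n k = if k ≤ᵇ n then p k else (N (suc n) - sum0to n (λ j → p j * D (suc n ∸ j))) * c

    -- Defs keeps the table behind divS private (entry n k: the k-th coefficient after n rounds of the
    -- recursion); unfolding divS at suc (suc n) exposes it as a pattern, so unification recovers it.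
    prefixTable : Σ (ℕ → ℕ → ℚ) λ P →
                  ∀ n → divS N D c (suc (suc n)) ≡ step (step (P n) n) (suc n) (suc (suc n))
    prefixTable = _ , λ n → refl

    prefix : ℕ → ℕ → ℚ
    prefix = proj₁ prefixTable

    prefix-stable : ∀ n k → k ℕ.≤ n → prefix n k ≡ divS N D c k
    prefix-stable zero    zero    z≤n = refl
    prefix-stable (suc n) k       k≤1+n with k ℕ.≤? n
    ... | yes k≤n = trans (if-≤ᵇ-yes k≤n) (prefix-stable n k k≤n)
    ... | no  k≰n with ℕ.≤-antisym k≤1+n (ℕ.≰⇒> k≰n)
    ...   | refl = refl

  divS-suc : ∀ n → divS N D c (suc n) ≡ (N (suc n) - sum0to n (λ j → divS N D c j * D (suc n ∸ j))) * c
  divS-suc n = trans (if-≤ᵇ-no (ℕ.n≮n n)) (cong (λ s → (N (suc n) - s) * c)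
    (sum-cong-≤ n (λ j j≤n → cong (_* D (suc n ∸ j)) (prefix-stable n j j≤n))))

  module _ (D₀*c≡1 : D 0 * c ≡ 1ℚ) where

    private
      *c*D₀ : ∀ x → x * c * D 0 ≡ x
      *c*D₀ x = trans (ℚ.*-assoc x c (D 0))
        (trans (cong (x *_) (trans (ℚ.*-comm c (D 0)) D₀*c≡1)) (ℚ.*-identityʳ x))

      ⊛-suc : ∀ (f : Series) n → (f ⊛ D) (suc n) ≡ sum0to n (λ j → f j * D (suc n ∸ j)) + f (suc n) * D 0
      ⊛-suc f n = cong (λ t → sum0to n (λ j → f j * D (suc n ∸ j)) + f (suc n) * D t) (ℕ.n∸n≡0 n)

    divS-⊛ : ∀ n → (divS N D c ⊛ D) n ≡ N n
    divS-⊛ zero    = *c*D₀ (N 0)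
    divS-⊛ (suc n) = begin
      (divS N D c ⊛ D) (suc n)              ≡⟨ ⊛-suc (divS N D c) n ⟩
      S + divS N D c (suc n) * D 0          ≡⟨ cong (λ t → S + t * D 0) (divS-suc n) ⟩
      S + (N (suc n) - S) * c * D 0         ≡⟨ cong (S +_) (*c*D₀ (N (suc n) - S)) ⟩
      S + (N (suc n) - S)                   ≡⟨ solve 2 (λ S x → S :+ (x :- S) := x) refl S (N (suc n)) ⟩
      N (suc n)                             ∎
      where
      open ≡-Reasoning
      S = sum0to n (λ j → divS N D c j * D (suc n ∸ j))

    divS-unique : ∀ (f : Series) → (∀ n → (f ⊛ D) n ≡ N n) → ∀ n → f n ≡ divS N D c n
    divS-unique f f⊛D≡N = <-rec (λ n → f n ≡ divS N D c n) agree
      where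
      agree : ∀ n → (∀ {j} → j ℕ.< n → f j ≡ divS N D c j) → f n ≡ divS N D c n
      agree zero    _        = *-inverse⇒solve D₀*c≡1 (f⊛D≡N 0)
      agree (suc n) f≡q-below = begin
        f (suc n)                                                        ≡⟨ *-inverse⇒solve D₀*c≡1 (+-move-left
                                                                              (trans (sym (⊛-suc f n)) (f⊛D≡N (suc n)))) ⟩
        (N (suc n) - sum0to n (λ j → f j * D (suc n ∸ j))) * c           ≡⟨ cong (λ s → (N (suc n) - s) * c)
                                                                              (sum-cong-≤ n (λ j j≤n → cong (_* D (suc n ∸ j)) (f≡q-below (s≤s j≤n)))) ⟩
        (N (suc n) - sum0to n (λ j → divS N D c j * D (suc n ∸ j))) * c  ≡⟨ divS-suc n ⟨
        divS N D c (suc n)                                               ∎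
        where open ≡-Reasoning

denom₀*denom₀⁻¹≡1 : ∀ m → denom m 0 * denom₀⁻¹ m ≡ 1ℚ
denom₀*denom₀⁻¹≡1 zero    = ℚ.*-inverseʳ (denom zero 0)
denom₀*denom₀⁻¹≡1 (suc m) = ℚ.*-inverseʳ (denom (suc m) 0)

eulerSeries : ℕ → ℚ → Series
eulerSeries m z = divS (numer m z) (denom m) (denom₀⁻¹ m)

eulerSeries-appell : ∀ m z n → eulerSeries m z n ≡ (eulerSeries m 0ℚ ⊛ expS z) n
eulerSeries-appell m z n =
  sym (Division.divS-unique (numer m z) D (denom₀⁻¹ m) (denom₀*denom₀⁻¹≡1 m) (q₀ ⊛ expS z) solves n)
  where
  D = denom m
  q₀ = eulerSeries m 0ℚ
  leading : Series
  leading k = if k ℕ.≡ᵇ m then ⟦ 2 ⟧ * inv! m else 0ℚ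
  q₀⊛D≡leading : ∀ k → (q₀ ⊛ D) k ≡ leading k
  q₀⊛D≡leading k = trans (Division.divS-⊛ (numer m 0ℚ) D (denom₀⁻¹ m) (denom₀*denom₀⁻¹≡1 m) k) (⊛-expS0 leading k)
  solves : ∀ k → ((q₀ ⊛ expS z) ⊛ D) k ≡ numer m z k
  solves k = begin
    ((q₀ ⊛ expS z) ⊛ D) k    ≡⟨ ⊛-assoc q₀ (expS z) D k ⟩
    (q₀ ⊛ (expS z ⊛ D)) k    ≡⟨ ⊛-congʳ q₀ (⊛-comm (expS z) D) k ⟩
    (q₀ ⊛ (D ⊛ expS z)) k    ≡⟨ ⊛-assoc q₀ D (expS z) k ⟨
    ((q₀ ⊛ D) ⊛ expS z) k    ≡⟨ ⊛-congˡ (expS z) q₀⊛D≡leading k ⟩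
    (leading ⊛ expS z) k     ∎
    where open ≡-Reasoning

⊛-scaleʳ : ∀ (f g : Series) z k → (f ⊛ (λ i → z * g i)) k ≡ z * (f ⊛ g) k
⊛-scaleʳ f g z k = trans
  (sum-cong k (λ i → solve 3 (λ u z w → u :* (z :* w) := z :* (u :* w)) refl (f i) z (g (k ∸ i))))
  (sym (*-distribˡ-sum k z _))

⊛-affineˡ : ∀ a (f h g : Series) k → ((λ i → a * f i + h i) ⊛ g) k ≡ a * (f ⊛ g) k + (h ⊛ g) k
⊛-affineˡ a f h g k = begin
  sum0to k (λ i → (a * f i + h i) * g (k ∸ i))                  ≡⟨ sum-cong k (λ i → solve 4
                                                                     (λ a u v w → (a :* u :+ v) :* w := a :* (u :* w) :+ v :* w) refl
                                                                     a (f i) (h i) (g (k ∸ i))) ⟩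
  sum0to k (λ i → a * (f i * g (k ∸ i)) + h i * g (k ∸ i))      ≡⟨ sum-+ k _ _ ⟩
  sum0to k (λ i → a * (f i * g (k ∸ i))) + (h ⊛ g) k            ≡⟨ cong (_+ (h ⊛ g) k) (*-distribˡ-sum k a _) ⟨
  a * (f ⊛ g) k + (h ⊛ g) k                                     ∎
  where open ≡-Reasoning

deriv-⊛-expS : ∀ (f : Series) z k → deriv (f ⊛ expS z) k ≡ (deriv f ⊛ expS z) k + z * (f ⊛ expS z) k
deriv-⊛-expS f z k = trans (deriv-⊛ f (expS z) k)
  (cong ((deriv f ⊛ expS z) k +_) (trans (⊛-congʳ f (deriv-expS z) k) (⊛-scaleʳ f (expS z) z k)))

-- ordinary coefficients of the exponential generating function (eᵗ - 1)^μ / μ!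
stirlingSeries : ℕ → Series
stirlingSeries μ l = ⟦ S₂ l μ ⟧ * inv! l

deriv-stirlingSeries-zero : ∀ l → deriv (stirlingSeries 0) l ≡ 0ℚ
deriv-stirlingSeries-zero l = trans (cong (⟦ suc l ⟧ *_) (ℚ.*-zeroˡ (inv! (suc l)))) (ℚ.*-zeroʳ ⟦ suc l ⟧)

deriv-stirlingSeries-suc : ∀ μ l →
  deriv (stirlingSeries (suc μ)) l ≡ ⟦ suc μ ⟧ * stirlingSeries (suc μ) l + stirlingSeries μ l
deriv-stirlingSeries-suc μ l = begin
  ⟦ suc l ⟧ * (⟦ suc μ ℕ.* S₂ l (suc μ) ℕ.+ S₂ l μ ⟧ * inv! (suc l))
      ≡⟨ cong (λ t → ⟦ suc l ⟧ * (t * inv! (suc l)))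
           (trans (⟦⟧-homo-+ (suc μ ℕ.* S₂ l (suc μ)) (S₂ l μ)) (cong (_+ ⟦ S₂ l μ ⟧) (⟦⟧-homo-* (suc μ) (S₂ l (suc μ))))) ⟩
  ⟦ suc l ⟧ * ((⟦ suc μ ⟧ * ⟦ S₂ l (suc μ) ⟧ + ⟦ S₂ l μ ⟧) * inv! (suc l))
      ≡⟨ solve 5 (λ c a b d j → c :* ((a :* b :+ d) :* j) := a :* (b :* (c :* j)) :+ d :* (c :* j)) refl
           ⟦ suc l ⟧ ⟦ suc μ ⟧ ⟦ S₂ l (suc μ) ⟧ ⟦ S₂ l μ ⟧ (inv! (suc l)) ⟩
  ⟦ suc μ ⟧ * (⟦ S₂ l (suc μ) ⟧ * (⟦ suc l ⟧ * inv! (suc l))) + ⟦ S₂ l μ ⟧ * (⟦ suc l ⟧ * inv! (suc l))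
      ≡⟨ cong₂ (λ u v → ⟦ suc μ ⟧ * (⟦ S₂ l (suc μ) ⟧ * u) + ⟦ S₂ l μ ⟧ * v) (inv!-suc l) (inv!-suc l) ⟨
  ⟦ suc μ ⟧ * stirlingSeries (suc μ) l + stirlingSeries μ l
      ∎
  where open ≡-Reasoning

stirlingExp : ℕ → ℚ → Series
stirlingExp μ z = stirlingSeries μ ⊛ expS z

deriv-stirlingExp-zero : ∀ z k → deriv (stirlingExp 0 z) k ≡ z * stirlingExp 0 z k
deriv-stirlingExp-zero z k = begin
  deriv (stirlingExp 0 z) k                                          ≡⟨ deriv-⊛-expS (stirlingSeries 0) z k ⟩
  (deriv (stirlingSeries 0) ⊛ expS z) k + z * stirlingExp 0 z k      ≡⟨ cong (_+ z * stirlingExp 0 z k) vanishes ⟩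
  0ℚ + z * stirlingExp 0 z k                                         ≡⟨ ℚ.+-identityˡ _ ⟩
  z * stirlingExp 0 z k                                              ∎
  where
  open ≡-Reasoning
  vanishes : (deriv (stirlingSeries 0) ⊛ expS z) k ≡ 0ℚ
  vanishes = trans (sum-cong k (λ i → trans (cong (_* expS z (k ∸ i)) (deriv-stirlingSeries-zero i)) (ℚ.*-zeroˡ (expS z (k ∸ i)))))
    (sum-head k (λ _ → 0ℚ) (λ _ → refl))

deriv-stirlingExp-suc : ∀ μ z k →
  deriv (stirlingExp (suc μ) z) k ≡ (⟦ suc μ ⟧ + z) * stirlingExp (suc μ) z k + stirlingExp μ z k
deriv-stirlingExp-suc μ z k = begin
  deriv (stirlingExp (suc μ) z) k
      ≡⟨ deriv-⊛-expS (stirlingSeries (suc μ)) z k ⟩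
  (deriv (stirlingSeries (suc μ)) ⊛ expS z) k + z * stirlingExp (suc μ) z k
      ≡⟨ cong (_+ z * stirlingExp (suc μ) z k)
           (trans (⊛-congˡ (expS z) (deriv-stirlingSeries-suc μ) k) (⊛-affineˡ ⟦ suc μ ⟧ _ _ (expS z) k)) ⟩
  ⟦ suc μ ⟧ * stirlingExp (suc μ) z k + stirlingExp μ z k + z * stirlingExp (suc μ) z k
      ≡⟨ solve 4 (λ a b b′ z → a :* b :+ b′ :+ z :* b := (a :+ z) :* b :+ b′) refl
           ⟦ suc μ ⟧ (stirlingExp (suc μ) z k) (stirlingExp μ z k) z ⟩
  (⟦ suc μ ⟧ + z) * stirlingExp (suc μ) z k + stirlingExp μ z k
      ∎
  where open ≡-Reasoning

*-cancelʳ-invertible : ∀ {a b c w} → c * w ≡ 1ℚ → a * c ≡ b * c → a ≡ b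
*-cancelʳ-invertible c*w≡1 a*c≡b*c = trans (*-inverse⇒solve c*w≡1 a*c≡b*c) (sym (*-inverse⇒solve c*w≡1 refl))

deriv-injective : ∀ {f g : Series} k → deriv f k ≡ deriv g k → f (suc k) ≡ g (suc k)
deriv-injective {f} {g} k f′≡g′ = *-cancelʳ-invertible {c = ⟦ suc k ⟧} ⟦1+k⟧*w≡1
  (trans (ℚ.*-comm (f (suc k)) _) (trans f′≡g′ (ℚ.*-comm _ (g (suc k)))))
  where
  ⟦1+k⟧*w≡1 : ⟦ suc k ⟧ * (⟦ k ! ⟧ * inv! (suc k)) ≡ 1ℚ
  ⟦1+k⟧*w≡1 = trans (sym (ℚ.*-assoc ⟦ suc k ⟧ ⟦ k ! ⟧ (inv! (suc k))))
    (trans (cong (_* inv! (suc k)) (sym (⟦⟧-homo-* (suc k) (k !)))) (⟦n!⟧*inv!≡1 (suc k)))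

rising-suc : ∀ x μ → rising x (suc μ) ≡ x * rising (x + 1ℚ) μ
rising-suc x zero    = trans (ℚ.*-identityˡ _) (trans (ℚ.+-identityʳ x) (sym (ℚ.*-identityʳ x)))
rising-suc x (suc μ) = begin
  rising x (suc μ) * (x + ⟦ 1 ℕ.+ μ ⟧)               ≡⟨ cong₂ (λ r t → r * (x + t)) (rising-suc x μ) (⟦⟧-homo-+ 1 μ) ⟩
  x * rising (x + 1ℚ) μ * (x + (1ℚ + ⟦ μ ⟧))          ≡⟨ solve 3 (λ x r m → x :* r :* (x :+ (con 1ℚ :+ m)) := x :* (r :* ((x :+ con 1ℚ) :+ m))) refl
                                                          x (rising (x + 1ℚ) μ) ⟦ μ ⟧ ⟩
  x * (rising (x + 1ℚ) μ * ((x + 1ℚ) + ⟦ μ ⟧))        ∎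
  where open ≡-Reasoning

risingExpansion : ℕ → ℚ → ℚ → Series
risingExpansion N x y k = sum0to N (λ μ → rising x μ * stirlingExp μ (y - ⟦ μ ⟧) k)

deriv-risingExpansion : ∀ N x y k →
  deriv (risingExpansion (suc N) x y) k ≡ y * risingExpansion (suc N) x y k + x * risingExpansion N (x + 1ℚ) (y - 1ℚ) k
deriv-risingExpansion N x y k = begin
  ⟦ suc k ⟧ * sum0to (suc N) (A (suc k))                     ≡⟨ *-distribˡ-sum (suc N) ⟦ suc k ⟧ (A (suc k)) ⟩
  sum0to (suc N) (λ μ → ⟦ suc k ⟧ * A (suc k) μ)             ≡⟨ sum-uncons N _ ⟩
  ⟦ suc k ⟧ * A (suc k) 0 + sum0to N (λ μ → ⟦ suc k ⟧ * A (suc k) (suc μ))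
                                                             ≡⟨ cong₂ _+_ first (sum-cong N later) ⟩
  y * A k 0 + sum0to N (λ μ → y * A k (suc μ) + x * B μ)     ≡⟨ cong (y * A k 0 +_) (sum-+ N _ _) ⟩
  y * A k 0 + (sum0to N (λ μ → y * A k (suc μ)) + sum0to N (λ μ → x * B μ))
                                                             ≡⟨ cong₂ (λ u v → y * A k 0 + (u + v)) (*-distribˡ-sum N y _) (*-distribˡ-sum N x B) ⟨
  y * A k 0 + (y * sum0to N (λ μ → A k (suc μ)) + x * sum0to N B)
                                                             ≡⟨ solve 5 (λ y a s x b → y :* a :+ (y :* s :+ x :* b) := y :* (a :+ s) :+ x :* b) refl
                                                                  y (A k 0) (sum0to N (λ μ → A k (suc μ))) x (sum0to N B) ⟩
  y * (A k 0 + sum0to N (λ μ → A k (suc μ))) + x * sum0to N B ≡⟨ cong (λ t → y * t + x * sum0to N B) (sum-uncons N (A k)) ⟨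
  y * sum0to (suc N) (A k) + x * sum0to N B                  ∎
  where
  open ≡-Reasoning
  A : ℕ → ℕ → ℚ
  A j μ = rising x μ * stirlingExp μ (y - ⟦ μ ⟧) j
  B : ℕ → ℚ
  B μ = rising (x + 1ℚ) μ * stirlingExp μ ((y - 1ℚ) - ⟦ μ ⟧) k
  pull : ∀ r s → ⟦ suc k ⟧ * (r * s) ≡ r * (⟦ suc k ⟧ * s)
  pull r s = solve 3 (λ c r s → c :* (r :* s) := r :* (c :* s)) refl ⟦ suc k ⟧ r s
  first : ⟦ suc k ⟧ * A (suc k) 0 ≡ y * A k 0
  first = begin
    ⟦ suc k ⟧ * A (suc k) 0                               ≡⟨ pull (rising x 0) _ ⟩
    rising x 0 * deriv (stirlingExp 0 (y - ⟦ 0 ⟧)) k      ≡⟨ cong (rising x 0 *_) (deriv-stirlingExp-zero (y - ⟦ 0 ⟧) k) ⟩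
    rising x 0 * ((y - ⟦ 0 ⟧) * stirlingExp 0 (y - ⟦ 0 ⟧) k)
                                                          ≡⟨ cong (λ t → rising x 0 * (t * stirlingExp 0 (y - ⟦ 0 ⟧) k)) (ℚ.+-identityʳ y) ⟩
    rising x 0 * (y * stirlingExp 0 (y - ⟦ 0 ⟧) k)        ≡⟨ solve 3 (λ r y s → r :* (y :* s) := y :* (r :* s)) refl (rising x 0) y _ ⟩
    y * A k 0                                             ∎
  later : ∀ μ → ⟦ suc k ⟧ * A (suc k) (suc μ) ≡ y * A k (suc μ) + x * B μ
  later μ = begin
    ⟦ suc k ⟧ * A (suc k) (suc μ)                         ≡⟨ pull r _ ⟩
    r * deriv (stirlingExp (suc μ) z) k                   ≡⟨ cong (r *_) (deriv-stirlingExp-suc μ z k) ⟩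
    r * ((⟦ suc μ ⟧ + z) * stirlingExp (suc μ) z k + stirlingExp μ z k)
                                                          ≡⟨ solve 5 (λ r a y b b′ → r :* ((a :+ (y :- a)) :* b :+ b′) := y :* (r :* b) :+ r :* b′) refl
                                                               r ⟦ suc μ ⟧ y (stirlingExp (suc μ) z k) (stirlingExp μ z k) ⟩
    y * A k (suc μ) + r * stirlingExp μ z k               ≡⟨ cong₂ (λ r′ z′ → y * A k (suc μ) + r′ * stirlingExp μ z′ k) (rising-suc x μ) shift ⟩
    y * A k (suc μ) + x * rising (x + 1ℚ) μ * stirlingExp μ ((y - 1ℚ) - ⟦ μ ⟧) k
                                                          ≡⟨ cong (y * A k (suc μ) +_) (ℚ.*-assoc x _ _) ⟩
    y * A k (suc μ) + x * B μ                             ∎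
    where
    r = rising x (suc μ)
    z = y - ⟦ suc μ ⟧
    shift : y - ⟦ suc μ ⟧ ≡ (y - 1ℚ) - ⟦ μ ⟧
    shift = trans (cong (λ t → y - t) (⟦⟧-homo-+ 1 μ))
      (solve 2 (λ y m → y :- (con 1ℚ :+ m) := (y :- con 1ℚ) :- m) refl y ⟦ μ ⟧)

risingExpansion≡expS : ∀ k N → k ℕ.≤ N → ∀ x y → risingExpansion N x y k ≡ expS (x + y) k
risingExpansion≡expS zero    N       _         x y = sum-head N _ (λ μ → ℚ.*-zeroʳ (rising x (suc μ)))
risingExpansion≡expS (suc k) (suc N) (s≤s k≤N) x y = deriv-injective {risingExpansion (suc N) x y} {expS (x + y)} k (begin
  deriv (risingExpansion (suc N) x y) k                                          ≡⟨ deriv-risingExpansion N x y k ⟩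
  y * risingExpansion (suc N) x y k + x * risingExpansion N (x + 1ℚ) (y - 1ℚ) k  ≡⟨ cong₂ (λ u v → y * u + x * v)
                                                                                      (risingExpansion≡expS k (suc N) (ℕ.m≤n⇒m≤1+n k≤N) x y)
                                                                                      (risingExpansion≡expS k N k≤N (x + 1ℚ) (y - 1ℚ)) ⟩
  y * expS (x + y) k + x * expS ((x + 1ℚ) + (y - 1ℚ)) k                          ≡⟨ cong (λ t → y * expS (x + y) k + x * expS t k)
                                                                                      (solve 2 (λ x y → (x :+ con 1ℚ) :+ (y :- con 1ℚ) := x :+ y) refl x y) ⟩
  y * expS (x + y) k + x * expS (x + y) k                                        ≡⟨ solve 3 (λ x y e → y :* e :+ x :* e := (x :+ y) :* e) refl
                                                                                      x y (expS (x + y) k) ⟩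
  (x + y) * expS (x + y) k                                                       ≡⟨ deriv-expS (x + y) k ⟨
  deriv (expS (x + y)) k                                                         ∎)
  where open ≡-Reasoning

⊛-risingExpansion : ∀ (f : Series) x y n →
  sum0to n (λ μ → rising x μ * (f ⊛ stirlingExp μ (y - ⟦ μ ⟧)) n) ≡ (f ⊛ expS (x + y)) n
⊛-risingExpansion f x y n = begin
  sum0to n (λ μ → rising x μ * (f ⊛ β μ) n)                          ≡⟨ sum-cong n (λ μ → *-distribˡ-sum n (rising x μ) _) ⟩
  sum0to n (λ μ → sum0to n (λ k → rising x μ * (f k * β μ (n ∸ k))))  ≡⟨ sum-cong n (λ μ → sum-cong n (λ k → reorder μ k)) ⟩
  sum0to n (λ μ → sum0to n (λ k → f k * (rising x μ * β μ (n ∸ k))))  ≡⟨ sum-comm n n _ ⟩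
  sum0to n (λ k → sum0to n (λ μ → f k * (rising x μ * β μ (n ∸ k))))  ≡⟨ sum-cong n (λ k → *-distribˡ-sum n (f k) _) ⟨
  sum0to n (λ k → f k * risingExpansion n x y (n ∸ k))                ≡⟨ sum-cong n (λ k → cong (f k *_)
                                                                           (risingExpansion≡expS (n ∸ k) n (ℕ.m∸n≤m n k) x y)) ⟩
  (f ⊛ expS (x + y)) n                                                ∎
  where
  open ≡-Reasoning
  β : ℕ → Series
  β μ = stirlingExp μ (y - ⟦ μ ⟧)
  reorder : ∀ μ k → rising x μ * (f k * β μ (n ∸ k)) ≡ f k * (rising x μ * β μ (n ∸ k))
  reorder μ k = solve 3 (λ r a b → r :* (a :* b) := a :* (r :* b)) refl (rising x μ) (f k) (β μ (n ∸ k))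

stirlingSeries-⊛-eulerSeries : ∀ m μ z n →
  (stirlingSeries μ ⊛ eulerSeries m z) n ≡ (eulerSeries m 0ℚ ⊛ stirlingExp μ z) n
stirlingSeries-⊛-eulerSeries m μ z n = begin
  (s ⊛ eulerSeries m z) n      ≡⟨ ⊛-congʳ s (eulerSeries-appell m z) n ⟩
  (s ⊛ (q₀ ⊛ expS z)) n        ≡⟨ ⊛-assoc s q₀ (expS z) n ⟨
  ((s ⊛ q₀) ⊛ expS z) n        ≡⟨ ⊛-congˡ (expS z) (⊛-comm s q₀) n ⟩
  ((q₀ ⊛ s) ⊛ expS z) n        ≡⟨ ⊛-assoc q₀ s (expS z) n ⟩
  (q₀ ⊛ stirlingExp μ z) n     ∎
  where
  open ≡-Reasoning
  s = stirlingSeries μ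
  q₀ = eulerSeries m 0ℚ

sumFromTo≡sum0to : ∀ a n (f : ℕ → ℚ) → (∀ i → i ℕ.< a → f i ≡ 0ℚ) → sumFromTo a n f ≡ sum0to n f
sumFromTo≡sum0to a n f f<a≡0 = sum-cong n guard
  where
  guard : ∀ i → (if a ≤ᵇ i then f i else 0ℚ) ≡ f i
  guard i with a ℕ.≤? i
  ... | yes a≤i = if-≤ᵇ-yes a≤i
  ... | no  a≰i = trans (if-≤ᵇ-no a≰i) (sym (f<a≡0 i (ℕ.≰⇒> a≰i)))

S₂-< : ∀ {l μ} → l ℕ.< μ → S₂ l μ ≡ 0
S₂-< {zero}  {suc μ} _         = refl
S₂-< {suc l} {suc μ} (s≤s l<μ) =
  cong₂ ℕ._+_ (trans (cong (suc μ ℕ.*_) (S₂-< (ℕ.m≤n⇒m≤1+n l<μ))) (ℕ.*-zeroʳ (suc μ))) (S₂-< l<μ)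

⟦C⟧*⟦[n∸l]!⟧ : ∀ {n l} → l ℕ.≤ n → ⟦ n C l ⟧ * ⟦ (n ∸ l) ! ⟧ ≡ ⟦ n ! ⟧ * inv! l
⟦C⟧*⟦[n∸l]!⟧ {n} {l} l≤n = begin
  ⟦ n C l ⟧ * ⟦ (n ∸ l) ! ⟧                            ≡⟨ ℚ.*-identityʳ _ ⟨
  ⟦ n C l ⟧ * ⟦ (n ∸ l) ! ⟧ * 1ℚ                       ≡⟨ cong (⟦ n C l ⟧ * ⟦ (n ∸ l) ! ⟧ *_) (⟦n!⟧*inv!≡1 l) ⟨
  ⟦ n C l ⟧ * ⟦ (n ∸ l) ! ⟧ * (⟦ l ! ⟧ * inv! l)       ≡⟨ solve 4 (λ c f a i → c :* f :* (a :* i) := c :* (a :* f) :* i) refl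
                                                             ⟦ n C l ⟧ ⟦ (n ∸ l) ! ⟧ ⟦ l ! ⟧ (inv! l) ⟩
  ⟦ n C l ⟧ * (⟦ l ! ⟧ * ⟦ (n ∸ l) ! ⟧) * inv! l       ≡⟨ cong (λ t → ⟦ n C l ⟧ * t * inv! l) (⟦⟧-homo-* (l !) ((n ∸ l) !)) ⟨
  ⟦ n C l ⟧ * ⟦ l ! ℕ.* (n ∸ l) ! ⟧ * inv! l           ≡⟨ cong (_* inv! l) (⟦⟧-homo-* (n C l) (l ! ℕ.* (n ∸ l) !)) ⟨
  ⟦ (n C l) ℕ.* (l ! ℕ.* (n ∸ l) !) ⟧ * inv! l           ≡⟨ cong (λ t → ⟦ t ⟧ * inv! l) C*l!*[n∸l]!≡n! ⟩
  ⟦ n ! ⟧ * inv! l                                     ∎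
  where
  open ≡-Reasoning
  C*l!*[n∸l]!≡n! : (n C l) ℕ.* (l ! ℕ.* (n ∸ l) !) ≡ n !
  C*l!*[n∸l]!≡n! = trans (cong (ℕ._* (l ! ℕ.* (n ∸ l) !)) (nCk≡n!/k![n-k]! l≤n))
    (m/n*n≡m {{l ℕ.!* (n ∸ l) !≢0}} (k![n∸k]!∣n! l≤n))

stirling-binomial-sum : ∀ m n μ z x →
  sumFromTo μ n (λ l → ⟦ S₂ l μ ⟧ * ⟦ n C l ⟧ * E m (n ∸ l) z * rising x μ)
    ≡ ⟦ n ! ⟧ * (rising x μ * (stirlingSeries μ ⊛ eulerSeries m z) n)
stirling-binomial-sum m n μ z x = begin
  sumFromTo μ n term                                                           ≡⟨ sumFromTo≡sum0to μ n term vanish ⟩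
  sum0to n term                                                                ≡⟨ sum-cong-≤ n regroup ⟩
  sum0to n (λ l → ⟦ n ! ⟧ * (r * (stirlingSeries μ l * q (n ∸ l))))           ≡⟨ *-distribˡ-sum n ⟦ n ! ⟧ _ ⟨
  ⟦ n ! ⟧ * sum0to n (λ l → r * (stirlingSeries μ l * q (n ∸ l)))             ≡⟨ cong (⟦ n ! ⟧ *_) (*-distribˡ-sum n r _) ⟨
  ⟦ n ! ⟧ * (r * (stirlingSeries μ ⊛ q) n)                                     ∎
  where
  open ≡-Reasoning
  r = rising x μ
  q = eulerSeries m z
  term : ℕ → ℚ
  term l = ⟦ S₂ l μ ⟧ * ⟦ n C l ⟧ * E m (n ∸ l) z * r
  vanish : ∀ l → l ℕ.< μ → term l ≡ 0ℚ
  vanish l l<μ = trans (cong (λ s → ⟦ s ⟧ * ⟦ n C l ⟧ * E m (n ∸ l) z * r) (S₂-< l<μ))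
    (solve 3 (λ c e r → con 0ℚ :* c :* e :* r := con 0ℚ) refl ⟦ n C l ⟧ (E m (n ∸ l) z) r)
  regroup : ∀ l → l ℕ.≤ n → term l ≡ ⟦ n ! ⟧ * (r * (stirlingSeries μ l * q (n ∸ l)))
  regroup l l≤n = begin
    ⟦ S₂ l μ ⟧ * ⟦ n C l ⟧ * (⟦ (n ∸ l) ! ⟧ * q (n ∸ l)) * r
        ≡⟨ solve 5 (λ s c f q r → s :* c :* (f :* q) :* r := (c :* f) :* (r :* (s :* q))) refl
             ⟦ S₂ l μ ⟧ ⟦ n C l ⟧ ⟦ (n ∸ l) ! ⟧ (q (n ∸ l)) r ⟩
    (⟦ n C l ⟧ * ⟦ (n ∸ l) ! ⟧) * (r * (⟦ S₂ l μ ⟧ * q (n ∸ l)))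
        ≡⟨ cong (_* (r * (⟦ S₂ l μ ⟧ * q (n ∸ l)))) (⟦C⟧*⟦[n∸l]!⟧ l≤n) ⟩
    (⟦ n ! ⟧ * inv! l) * (r * (⟦ S₂ l μ ⟧ * q (n ∸ l)))
        ≡⟨ solve 5 (λ f i r s q → (f :* i) :* (r :* (s :* q)) := f :* (r :* ((s :* i) :* q))) refl
             ⟦ n ! ⟧ (inv! l) r ⟦ S₂ l μ ⟧ (q (n ∸ l)) ⟩
    ⟦ n ! ⟧ * (r * (stirlingSeries μ l * q (n ∸ l)))
        ∎

mainTheorem6 : (m n : ℕ) (x : ℚ) →
    E m n x ≡ sum0to n (λ μ → sumFromTo μ n (λ l →
      ⟦ S₂ l μ ⟧ * ⟦ n C l ⟧ * E m (n ∸ l) (- ⟦ μ ⟧) * rising x μ))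
mainTheorem6 m n x = sym (begin
  sum0to n (λ μ → sumFromTo μ n (λ l → ⟦ S₂ l μ ⟧ * ⟦ n C l ⟧ * E m (n ∸ l) (- ⟦ μ ⟧) * rising x μ))
      ≡⟨ sum-cong n (λ μ → stirling-binomial-sum m n μ (- ⟦ μ ⟧) x) ⟩
  sum0to n (λ μ → ⟦ n ! ⟧ * (rising x μ * (stirlingSeries μ ⊛ eulerSeries m (- ⟦ μ ⟧)) n))
      ≡⟨ *-distribˡ-sum n ⟦ n ! ⟧ _ ⟨
  ⟦ n ! ⟧ * sum0to n (λ μ → rising x μ * (stirlingSeries μ ⊛ eulerSeries m (- ⟦ μ ⟧)) n)
      ≡⟨ cong (⟦ n ! ⟧ *_) (sum-cong n (λ μ → cong (rising x μ *_) (trans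
           (stirlingSeries-⊛-eulerSeries m μ (- ⟦ μ ⟧) n)
           (cong (λ z → (eulerSeries m 0ℚ ⊛ stirlingExp μ z) n) (sym (ℚ.+-identityˡ (- ⟦ μ ⟧))))))) ⟩
  ⟦ n ! ⟧ * sum0to n (λ μ → rising x μ * (eulerSeries m 0ℚ ⊛ stirlingExp μ (0ℚ - ⟦ μ ⟧)) n)
      ≡⟨ cong (⟦ n ! ⟧ *_) (⊛-risingExpansion (eulerSeries m 0ℚ) x 0ℚ n) ⟩
  ⟦ n ! ⟧ * (eulerSeries m 0ℚ ⊛ expS (x + 0ℚ)) n
      ≡⟨ cong (λ y → ⟦ n ! ⟧ * (eulerSeries m 0ℚ ⊛ expS y) n) (ℚ.+-identityʳ x) ⟩
  ⟦ n ! ⟧ * (eulerSeries m 0ℚ ⊛ expS x) n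
      ≡⟨ cong (⟦ n ! ⟧ *_) (eulerSeries-appell m x n) ⟨
  E m n x
      ∎)
  where open ≡-Reasoning
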